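{- Let $E\in\mathcal P^e$. Then: (1) for any two distinct labels $\langle r,m\rangle,\langle r',m'\rangle\in top(E)$ we have $\{\langle r,m\rangle\}\,\Re\,\{\langle r',m'\rangle\}$; (2) for every $\langle s,n\rangle\in lab(E)$ there is $\langle r,m\rangle\in top(E)$ with $r\sqsubseteq s$ and $m\le n$. Moreover, let $E'\in\mathcal P^e_{gr}$ with $E\xrightarrow{\mu}E'$. Then: (3) for every $\langle r',m'\rangle\in top(E')$ there is $\langle r,m\rangle\in top(E)$ with $r\sqsubseteq r'$ and $m\le m'$; (4) $E'\in\mathcal P^e$.
   Context: Unlabeled processes. Let $\mathcal N$ be an infinite set of names. The set $\mathcal P$ of processes is generated by $P::=0\mid x(y).P\mid \bar xy.P\mid P\,|\,P\mid(\nu x)P\mid\, !P$; binders, $fn$, $bn$, $n(\cdot)$ as usual (alpha-conversion assumed). Actions $\mu$: $xy$, $\bar xy$, $\bar x(y)$, $\tau$, with $bn(\bar x(y))=\{y\}$, otherwise empty, $fn(xy)=fn(\bar xy)=\{x,y\}$, $fn(\bar x(y))=\{x\}$, $fn(\tau)=\emptyset$. The (early) transition relation is the least relation closed under: Input $x(y).P\xrightarrow{xz}P\{z/y\}$; Output $\bar xy.P\xrightarrow{\bar xy}P$; Open: $P\xrightarrow{\bar xy}P'$, $x\ne y$ imply $(\nu y)P\xrightarrow{\bar x(y)}P'$; Res: $P\xrightarrow{\mu}P'$, $y\notin n(\mu)$ imply $(\nu y)P\xrightarrow{\mu}(\nu y)P'$; Par: $P\xrightarrow{\mu}P'$, $bn(\mu)\cap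 fn(Q)=\emptyset$ imply $P|Q\xrightarrow{\mu}P'|Q$; Com: $P\xrightarrow{xy}P'$, $Q\xrightarrow{\bar xy}Q'$ imply $P|Q\xrightarrow{\tau}P'|Q'$; Close: $P\xrightarrow{xy}P'$, $Q\xrightarrow{\bar x(y)}Q'$, $y\notin fn(P)$ imply $P|Q\xrightarrow{\tau}(\nu y)(P'|Q')$; symmetric versions of Par, Com, Close; Rep: $P\xrightarrow{\mu}P'$ implies $!P\xrightarrow{\mu}P'|!P$. Labeled terms. Labels are pairs $\langle s,n\rangle\in\{0,1\}^*\times\mathbb N$; $s_0\sqsubseteq s_1$ means $s_0$ is a prefix of $s_1$; for label sets, $L_0\,\Re\,L_1$ iff for all $\langle s_0,n_0\rangle\in L_0$, $\langle s_1,n_1\rangle\in L_1$: $s_0\not\sqsubseteq s_1$ and $s_1\not\sqsubseteq s_0$. Ground labeled terms $\mathcal P^e_{gr}$: $E::=0\mid \mu_{\langle s,n\rangle}.E\mid(\nu x)E\mid E\,|\,E\mid\, !_{\langle s,n\rangle}P$, with $\mu$ a prefix $x(y)$ or $\bar xy$ and $P\in\mathcal P$ unlabeled. Labeling function: $L_{\langle s,n\rangle}(0)=0$; $L_{\langle s,n\rangle}(\mu.P)=\mu_{\langle s,n\rangle}.L_{\langle s,n+1\rangle}(P)$; $L_{\langle s,n\rangle}(P_0|P_1)=L_{\langle s0,n\rangle}(P_0)\,|\,L_{\langle s1,n\rangle}(P_1)$; $L_{\langle s,n\rangle}((\nu x)P)=(\nu x)L_{\langle s,n\rangle}(P)$;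 $L_{\langle s,n\rangle}(!P)=\,!_{\langle s,n\rangle}P$. $top(0)=lab(0)=\emptyset$; $top(\mu_v.E)=\{v\}$, $lab(\mu_v.E)=\{v\}\cup lab(E)$; $top,lab$ of $(\nu x)E$ equal those of $E$; $top(E_0|E_1)=top(E_0)\cup top(E_1)$, $lab(E_0|E_1)=lab(E_0)\cup lab(E_1)$; $top(!_vP)=lab(!_vP)=\{v\}$. $wf$ is the least predicate with: $wf(0)$; $wf(L_{\langle s,n\rangle}(\mu.P))$ for every $\mu.P\in\mathcal P$ and label; $wf(E_0|E_1)$ if $wf(E_0)$, $wf(E_1)$, $top(E_0)\,\Re\,top(E_1)$; $wf((\nu x)E)$ if $wf(E)$; $wf(!_{\langle s,n\rangle}P)$ for every $P\in\mathcal P$ and label. $\mathcal P^e=\{E\in\mathcal P^e_{gr}:wf(E)\}$. Labeled transitions use the unlabeled rules with labels ignored (e.g. $x(y)_v.E\xrightarrow{xz}E\{z/y\}$, substitution not affecting labels; $\bar xy_v.E\xrightarrow{\bar xy}E$), except replication: if $P\xrightarrow{\mu}P'$ (unlabeled) then $!_{\langle s,n\rangle}P\xrightarrow{\mu}L_{\langle s0,n+1\rangle}(P')\,|\,!_{\langle s1,n+1\rangle}P$. -}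

module Defs where

open import Data.Nat using (ℕ; zero; suc; _≤_; _≟_)
open import Data.Bool using (Bool; true; false; if_then_else_)
open import Data.List using (List; []; _∷_; _++_; [_])
open import Data.List.Membership.Propositional using (_∈_; _∉_)
open import Data.Product using (_×_; _,_; ∃; proj₁; proj₂)
open import Relation.Nullary using (¬_; does)
open import Relation.Binary.PropositionalEquality using (_≡_; _≢_)

Name : Set
Name = ℕ

remove : Name → List Name → List Name
remove y []       = []
remove y (a ∷ as) = if does (a ≟ y) then remove y as else a ∷ remove y as

data Proc : Set where
  𝟘    : Proc
  inp  : Name → Name → Proc → Proc      -- x(y).P   (binds y)
  out  : Name → Name → Proc → Proc
  _∥_  : Proc → Proc → Proc
  ν    : Name → Proc → Proc             -- (νx)P    (binds x)
  !_   : Proc → Proc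

infixr 5 _∥_

fnP : Proc → List Name
fnP 𝟘           = []
fnP (inp x y P) = x ∷ remove y (fnP P)
fnP (out x y P) = x ∷ y ∷ fnP P
fnP (P ∥ Q)     = fnP P ++ fnP Q
fnP (ν x P)     = remove x (fnP P)
fnP (! P)       = fnP P

bnP : Proc → List Name
bnP 𝟘           = []
bnP (inp x y P) = y ∷ bnP P
bnP (out x y P) = bnP P
bnP (P ∥ Q)     = bnP P ++ bnP Q
bnP (ν x P)     = x ∷ bnP P
bnP (! P)       = bnP P

namesP : Proc → List Name
namesP 𝟘           = []
namesP (inp x y P) = x ∷ y ∷ namesP P
namesP (out x y P) = x ∷ y ∷ namesP P
namesP (P ∥ Q)     = namesP P ++ namesP Q
namesP (ν x P)     = x ∷ namesP P
namesP (! P)       = namesP P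

rn : Name → Name → Name → Name
rn z y a = if does (a ≟ y) then z else a

-- naive substitution P{z/y} of free occurrences of y by z (no renaming of
-- binders).  It is capture-avoiding whenever z ∉ bnP P; the general
-- (capture-avoiding, up to alpha) case is obtained via the alpha rules below.
substP : Name → Name → Proc → Proc
substP z y 𝟘           = 𝟘
substP z y (inp x w P) = inp (rn z y x) w (if does (w ≟ y) then P else substP z y P)
substP z y (out x w P) = out (rn z y x) (rn z y w) (substP z y P)
substP z y (P ∥ Q)     = substP z y P ∥ substP z y Q
substP z y (ν w P)     = ν w (if does (w ≟ y) then P else substP z y P)
substP z y (! P)       = ! substP z y P

data _≈αP_ : Proc → Proc → Set where
  α-refl  : ∀ {P} → P ≈αP P
  α-sym   : ∀ {P Q} → P ≈αP Q → Q ≈αP P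
  α-trans : ∀ {P Q R} → P ≈αP Q → Q ≈αP R → P ≈αP R
  α-inp   : ∀ {x y P Q} → P ≈αP Q → inp x y P ≈αP inp x y Q
  α-out   : ∀ {x y P Q} → P ≈αP Q → out x y P ≈αP out x y Q
  α-par   : ∀ {P P' Q Q'} → P ≈αP P' → Q ≈αP Q' → (P ∥ Q) ≈αP (P' ∥ Q')
  α-ν     : ∀ {x P Q} → P ≈αP Q → ν x P ≈αP ν x Q
  α-!     : ∀ {P Q} → P ≈αP Q → (! P) ≈αP (! Q)
  α-inp-ren : ∀ {x y w P} → w ∉ namesP P →
              inp x y P ≈αP inp x w (substP w y P)
  α-ν-ren   : ∀ {y w P} → w ∉ namesP P →
              ν y P ≈αP ν w (substP w y P)

data Act : Set where
  inA  : Name → Name → Act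
  outA : Name → Name → Act
  boutA : Name → Name → Act
  τ    : Act

bnA : Act → List Name
bnA (boutA x y) = [ y ]
bnA _           = []

fnA : Act → List Name
fnA (inA x y)   = x ∷ y ∷ []
fnA (outA x y)  = x ∷ y ∷ []
fnA (boutA x y) = [ x ]
fnA τ           = []

nA : Act → List Name
nA μ = fnA μ ++ bnA μ

Disjoint : List Name → List Name → Set
Disjoint as bs = ∀ {a} → a ∈ as → a ∉ bs

data _—[_]→P_ : Proc → Act → Proc → Set where
  t-inp   : ∀ {x y z P} → z ∉ bnP P →
            inp x y P —[ inA x z ]→P substP z y P
  t-out   : ∀ {x y P} → out x y P —[ outA x y ]→P P
  t-open  : ∀ {x y P P'} → P —[ outA x y ]→P P' → x ≢ y →
            ν y P —[ boutA x y ]→P P'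
  t-res   : ∀ {y μ P P'} → P —[ μ ]→P P' → y ∉ nA μ →
            ν y P —[ μ ]→P ν y P'
  t-parL  : ∀ {μ P P' Q} → P —[ μ ]→P P' → Disjoint (bnA μ) (fnP Q) →
            (P ∥ Q) —[ μ ]→P (P' ∥ Q)
  t-parR  : ∀ {μ P Q Q'} → Q —[ μ ]→P Q' → Disjoint (bnA μ) (fnP P) →
            (P ∥ Q) —[ μ ]→P (P ∥ Q')
  t-comL  : ∀ {x y P P' Q Q'} → P —[ inA x y ]→P P' → Q —[ outA x y ]→P Q' →
            (P ∥ Q) —[ τ ]→P (P' ∥ Q')
  t-comR  : ∀ {x y P P' Q Q'} → P —[ outA x y ]→P P' → Q —[ inA x y ]→P Q' →
            (P ∥ Q) —[ τ ]→P (P' ∥ Q')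
  t-closeL : ∀ {x y P P' Q Q'} → P —[ inA x y ]→P P' → Q —[ boutA x y ]→P Q' →
             y ∉ fnP P → (P ∥ Q) —[ τ ]→P ν y (P' ∥ Q')
  t-closeR : ∀ {x y P P' Q Q'} → P —[ boutA x y ]→P P' → Q —[ inA x y ]→P Q' →
             y ∉ fnP Q → (P ∥ Q) —[ τ ]→P ν y (P' ∥ Q')
  t-rep   : ∀ {μ P P'} → P —[ μ ]→P P' → (! P) —[ μ ]→P (P' ∥ (! P))
  -- processes are taken up to alpha-conversion
  t-alpha : ∀ {μ P P₀ P₀' P'} → P ≈αP P₀ → P₀ —[ μ ]→P P₀' → P₀' ≈αP P' →
            P —[ μ ]→P P'

-- Labels ⟨s,n⟩ ∈ {0,1}* × ℕ  (0 = false, 1 = true)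

Label : Set
Label = List Bool × ℕ

_⊑_ : List Bool → List Bool → Set
s₀ ⊑ s₁ = ∃ λ u → s₀ ++ u ≡ s₁

-- L₀ ℜ L₁ (label sets represented as lists)
_ℜ_ : List Label → List Label → Set
L₀ ℜ L₁ = ∀ {l₀ l₁} → l₀ ∈ L₀ → l₁ ∈ L₁ →
          ¬ (proj₁ l₀ ⊑ proj₁ l₁) × ¬ (proj₁ l₁ ⊑ proj₁ l₀)

data LTerm : Set where
  𝟘    : LTerm
  inp  : Label → Name → Name → LTerm → LTerm
  out  : Label → Name → Name → LTerm → LTerm
  _∥_  : LTerm → LTerm → LTerm
  ν    : Name → LTerm → LTerm
  rep  : Label → Proc → LTerm

L : Label → Proc → LTerm
L (s , n) 𝟘           = 𝟘
L (s , n) (inp x y P) = inp (s , n) x y (L (s , suc n) P)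
L (s , n) (out x y P) = out (s , n) x y (L (s , suc n) P)
L (s , n) (P ∥ Q)     = L (s ++ [ false ] , n) P ∥ L (s ++ [ true ] , n) Q
L (s , n) (ν x P)     = ν x (L (s , n) P)
L (s , n) (! P)       = rep (s , n) P

top : LTerm → List Label
top 𝟘             = []
top (inp v x y E) = [ v ]
top (out v x y E) = [ v ]
top (E ∥ F)       = top E ++ top F
top (ν x E)       = top E
top (rep v P)     = [ v ]

lab : LTerm → List Label
lab 𝟘             = []
lab (inp v x y E) = v ∷ lab E
lab (out v x y E) = v ∷ lab E
lab (E ∥ F)       = lab E ++ lab F
lab (ν x E)       = lab E
lab (rep v P)     = [ v ]

data wf : LTerm → Set where
  wf-𝟘   : wf 𝟘
  wf-inp : ∀ (x y : Name) (P : Proc) (v : Label) → wf (L v (inp x y P))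
  wf-out : ∀ (x y : Name) (P : Proc) (v : Label) → wf (L v (out x y P))
  wf-par : ∀ {E₀ E₁} → wf E₀ → wf E₁ → top E₀ ℜ top E₁ → wf (E₀ ∥ E₁)
  wf-ν   : ∀ {x E} → wf E → wf (ν x E)
  wf-rep : ∀ (v : Label) (P : Proc) → wf (rep v P)

fnE : LTerm → List Name
fnE 𝟘             = []
fnE (inp v x y E) = x ∷ remove y (fnE E)
fnE (out v x y E) = x ∷ y ∷ fnE E
fnE (E ∥ F)       = fnE E ++ fnE F
fnE (ν x E)       = remove x (fnE E)
fnE (rep v P)     = fnP P

bnE : LTerm → List Name
bnE 𝟘             = []
bnE (inp v x y E) = y ∷ bnE E
bnE (out v x y E) = bnE E
bnE (E ∥ F)       = bnE E ++ bnE F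
bnE (ν x E)       = x ∷ bnE E
bnE (rep v P)     = bnP P

namesE : LTerm → List Name
namesE 𝟘             = []
namesE (inp v x y E) = x ∷ y ∷ namesE E
namesE (out v x y E) = x ∷ y ∷ namesE E
namesE (E ∥ F)       = namesE E ++ namesE F
namesE (ν x E)       = x ∷ namesE E
namesE (rep v P)     = namesP P

substE : Name → Name → LTerm → LTerm
substE z y 𝟘             = 𝟘
substE z y (inp v x w E) = inp v (rn z y x) w (if does (w ≟ y) then E else substE z y E)
substE z y (out v x w E) = out v (rn z y x) (rn z y w) (substE z y E)
substE z y (E ∥ F)       = substE z y E ∥ substE z y F
substE z y (ν w E)       = ν w (if does (w ≟ y) then E else substE z y E)
substE z y (rep v P)     = rep v (substP z y P)

data _≈αE_ : LTerm → LTerm → Set where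
  α-refl  : ∀ {E} → E ≈αE E
  α-sym   : ∀ {E F} → E ≈αE F → F ≈αE E
  α-trans : ∀ {E F G} → E ≈αE F → F ≈αE G → E ≈αE G
  α-inp   : ∀ {v x y E F} → E ≈αE F → inp v x y E ≈αE inp v x y F
  α-out   : ∀ {v x y E F} → E ≈αE F → out v x y E ≈αE out v x y F
  α-par   : ∀ {E E' F F'} → E ≈αE E' → F ≈αE F' → (E ∥ F) ≈αE (E' ∥ F')
  α-ν     : ∀ {x E F} → E ≈αE F → ν x E ≈αE ν x F
  α-rep   : ∀ {v P Q} → P ≈αP Q → rep v P ≈αE rep v Q
  α-inp-ren : ∀ {v x y w E} → w ∉ namesE E →
              inp v x y E ≈αE inp v x w (substE w y E)
  α-ν-ren   : ∀ {y w E} → w ∉ namesE E →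
              ν y E ≈αE ν w (substE w y E)

-- Transition relation on labeled terms: as the unlabeled one (labels
-- ignored), except for replication.

data _—[_]→_ : LTerm → Act → LTerm → Set where
  t-inp   : ∀ {v x y z E} → z ∉ bnE E →
            inp v x y E —[ inA x z ]→ substE z y E
  t-out   : ∀ {v x y E} → out v x y E —[ outA x y ]→ E
  t-open  : ∀ {x y E E'} → E —[ outA x y ]→ E' → x ≢ y →
            ν y E —[ boutA x y ]→ E'
  t-res   : ∀ {y μ E E'} → E —[ μ ]→ E' → y ∉ nA μ →
            ν y E —[ μ ]→ ν y E'
  t-parL  : ∀ {μ E E' F} → E —[ μ ]→ E' → Disjoint (bnA μ) (fnE F) →
            (E ∥ F) —[ μ ]→ (E' ∥ F)
  t-parR  : ∀ {μ E F F'} → F —[ μ ]→ F' → Disjoint (bnA μ) (fnE E) →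
            (E ∥ F) —[ μ ]→ (E ∥ F')
  t-comL  : ∀ {x y E E' F F'} → E —[ inA x y ]→ E' → F —[ outA x y ]→ F' →
            (E ∥ F) —[ τ ]→ (E' ∥ F')
  t-comR  : ∀ {x y E E' F F'} → E —[ outA x y ]→ E' → F —[ inA x y ]→ F' →
            (E ∥ F) —[ τ ]→ (E' ∥ F')
  t-closeL : ∀ {x y E E' F F'} → E —[ inA x y ]→ E' → F —[ boutA x y ]→ F' →
             y ∉ fnE E → (E ∥ F) —[ τ ]→ ν y (E' ∥ F')
  t-closeR : ∀ {x y E E' F F'} → E —[ boutA x y ]→ E' → F —[ inA x y ]→ F' →
             y ∉ fnE F → (E ∥ F) —[ τ ]→ ν y (E' ∥ F')
  t-rep   : ∀ {μ s n P P'} → P —[ μ ]→P P' →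
            rep (s , n) P —[ μ ]→ (L (s ++ [ false ] , suc n) P' ∥ rep (s ++ [ true ] , suc n) P)
  -- labeled terms are taken up to alpha-conversion
  t-alpha : ∀ {μ E E₀ E₀' E'} → E ≈αE E₀ → E₀ —[ μ ]→ E₀' → E₀' ≈αE E' →
            E —[ μ ]→ E'

-- Every label of L⟨s,n⟩(P) lies above ⟨s,n⟩, and the two sides of a parallel
-- composition are labelled above the incomparable strings s0 and s1; hence
-- each L⟨s,n⟩(P) is well formed, and a well-formed term has separated top
-- labels lying below all its labels.  A transition replaces top prefixes and
-- replications by residuals labelled above them, so the top labels only move
-- upwards and the separation between parallel components survives.
-- Alpha-conversion and substitution touch names only: they preserve the
-- labelled shape of a term, on which top and wf depend exclusively.

module Submission where

open import Defs
open import Data.Nat using (_≤_)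
open import Data.List using (List; [_])
open import Data.List.Membership.Propositional using (_∈_)
open import Data.Product using (_×_; _,_; ∃)
open import Relation.Binary.PropositionalEquality using (_≢_)

open import Data.Nat using (suc; _≟_)
open import Data.Nat.Properties using (≤-refl; ≤-trans; n≤1+n)
open import Data.Bool using (true; false)
open import Data.List using ([]; _∷_; _++_)
open import Data.List.Properties using (++-assoc; ++-identityʳ; ∷-injective)
open import Data.List.Membership.Propositional.Properties using (∈-++⁻; ∈-++⁺ˡ; ∈-++⁺ʳ)
open import Data.List.Relation.Unary.Any using (here; there)
open import Data.Product using (proj₁; proj₂; swap)
open import Data.Sum using (_⊎_; inj₁; inj₂; [_,_]′)
open import Data.Empty using (⊥; ⊥-elim)
open import Data.Unit using (⊤; tt)
open import Relation.Nullary using (¬_; does)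
open import Relation.Binary.PropositionalEquality
  using (_≡_; refl; sym; trans; cong; cong₂; subst; subst₂)

⊑-refl : ∀ s → s ⊑ s
⊑-refl s = [] , ++-identityʳ s

⊑-trans : ∀ {a b c} → a ⊑ b → b ⊑ c → a ⊑ c
⊑-trans {a} (u , refl) (w , refl) = u ++ w , sym (++-assoc a u w)

⊑-++ : ∀ s {u} → s ⊑ (s ++ u)
⊑-++ s {u} = u , refl

⊑-comparable : ∀ a b {c} → a ⊑ c → b ⊑ c → a ⊑ b ⊎ b ⊑ a
⊑-comparable []      b       _         _       = inj₁ (b , refl)
⊑-comparable (x ∷ a) []      _         _       = inj₂ (x ∷ a , refl)
⊑-comparable (x ∷ a) (y ∷ b) (u , refl) (w , e) with ∷-injective e
... | refl , e′ with ⊑-comparable a b (u , refl) (w , e′)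
...   | inj₁ (v , a≡b) = inj₁ (v , cong (x ∷_) a≡b)
...   | inj₂ (v , b≡a) = inj₂ (v , cong (x ∷_) b≡a)

sibling-⋢ : ∀ s {b c} → b ≢ c → ¬ (s ++ [ b ]) ⊑ (s ++ [ c ])
sibling-⋢ []      b≢c (_ , e) = b≢c (proj₁ (∷-injective e))
sibling-⋢ (_ ∷ s) b≢c (u , e) = sibling-⋢ s b≢c (u , proj₂ (∷-injective e))

siblings-no-common-extension : ∀ s {b c d} → b ≢ c →
  (s ++ [ b ]) ⊑ d → (s ++ [ c ]) ⊑ d → ⊥
siblings-no-common-extension s {b} {c} b≢c p q
  with ⊑-comparable (s ++ [ b ]) (s ++ [ c ]) p q
... | inj₁ b⊑c = sibling-⋢ s b≢c b⊑c
... | inj₂ c⊑b = sibling-⋢ s (λ c≡b → b≢c (sym c≡b)) c⊑b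

branches-incomparable : ∀ s {a d} → (s ++ [ false ]) ⊑ a → (s ++ [ true ]) ⊑ d →
  ¬ a ⊑ d × ¬ d ⊑ a
branches-incomparable s p q =
  (λ a⊑d → siblings-no-common-extension s (λ ()) (⊑-trans p a⊑d) q) ,
  (λ d⊑a → siblings-no-common-extension s (λ ()) p (⊑-trans q d⊑a))

infix 4 _≼_

_≼_ : List Label → List Label → Set
A ≼ B = ∀ {r′ m′} → (r′ , m′) ∈ B →
  ∃ λ r → ∃ λ m → (r , m) ∈ A × r ⊑ r′ × m ≤ m′

≼-refl : ∀ A → A ≼ A
≼-refl A {r′} {m′} h = r′ , m′ , h , ⊑-refl r′ , ≤-refl

≼-++ : ∀ {A A′ B B′} → A ≼ A′ → B ≼ B′ → A ++ B ≼ A′ ++ B′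
≼-++ {A} {A′} A≼A′ B≼B′ h with ∈-++⁻ A′ h
... | inj₁ h′ = let r , m , k , rest = A≼A′ h′ in r , m , ∈-++⁺ˡ k , rest
... | inj₂ h′ = let r , m , k , rest = B≼B′ h′ in r , m , ∈-++⁺ʳ A k , rest

ℜ-sym : ∀ {A B} → A ℜ B → B ℜ A
ℜ-sym AℜB a b = swap (AℜB b a)

ℜ-monoˡ : ∀ {A A′ B} → A ≼ A′ → A ℜ B → A′ ℜ B
ℜ-monoˡ A≼A′ AℜB a′ b with A≼A′ a′
... | _ , _ , a , r⊑r′ , _ with AℜB a b
...   | r⋢s , s⋢r = (λ r′⊑s → r⋢s (⊑-trans r⊑r′ r′⊑s)) ,
                    (λ s⊑r′ → [ r⋢s , s⋢r ]′ (⊑-comparable _ _ r⊑r′ s⊑r′))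

ℜ-mono : ∀ {A A′ B B′} → A ≼ A′ → B ≼ B′ → A ℜ B → A′ ℜ B′
ℜ-mono A≼A′ B≼B′ AℜB = ℜ-sym (ℜ-monoˡ B≼B′ (ℜ-sym (ℜ-monoˡ A≼A′ AℜB)))

ℜ-singletons : ∀ {A B a b} → A ℜ B → a ∈ A → b ∈ B → [ a ] ℜ [ b ]
ℜ-singletons AℜB a∈A b∈B (here refl) (here refl) = AℜB a∈A b∈B

Separated : List Label → Set
Separated A = ∀ {r m r′ m′} → (r , m) ∈ A → (r′ , m′) ∈ A →
  (r , m) ≢ (r′ , m′) → [ (r , m) ] ℜ [ (r′ , m′) ]

separated-[] : Separated []
separated-[] ()

separated-[_] : ∀ v → Separated [ v ]
separated-[ v ] (here refl) (here refl) v≢v = ⊥-elim (v≢v refl)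

separated-++ : ∀ {A B} → Separated A → Separated B → A ℜ B → Separated (A ++ B)
separated-++ {A} sepA sepB AℜB a b with ∈-++⁻ A a | ∈-++⁻ A b
... | inj₁ a′ | inj₁ b′ = sepA a′ b′
... | inj₂ a′ | inj₂ b′ = sepB a′ b′
... | inj₁ a′ | inj₂ b′ = λ _ → ℜ-singletons AℜB a′ b′
... | inj₂ a′ | inj₁ b′ = λ _ → ℜ-singletons (ℜ-sym AℜB) a′ b′

top⊆lab : ∀ E {l} → l ∈ top E → l ∈ lab E
top⊆lab 𝟘             ()
top⊆lab (inp v x y E) (here e) = here e
top⊆lab (out v x y E) (here e) = here e
top⊆lab (E ∥ F)       h with ∈-++⁻ (top E) h
... | inj₁ h′ = ∈-++⁺ˡ (top⊆lab E h′)
... | inj₂ h′ = ∈-++⁺ʳ (lab E) (top⊆lab F h′)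
top⊆lab (ν x E)       h = top⊆lab E h
top⊆lab (rep v P)     h = h

lab-L : ∀ P s n {s′ n′} → (s′ , n′) ∈ lab (L (s , n) P) → s ⊑ s′ × n ≤ n′
lab-L (inp x y P) s n (here refl) = ⊑-refl s , ≤-refl
lab-L (out x y P) s n (here refl) = ⊑-refl s , ≤-refl
lab-L (! P)       s n (here refl) = ⊑-refl s , ≤-refl
lab-L (inp x y P) s n (there h) =
  let s⊑ , n< = lab-L P s (suc n) h in s⊑ , ≤-trans (n≤1+n n) n<
lab-L (out x y P) s n (there h) =
  let s⊑ , n< = lab-L P s (suc n) h in s⊑ , ≤-trans (n≤1+n n) n<
lab-L (P ∥ Q)     s n h with ∈-++⁻ (lab (L (s ++ [ false ] , n) P)) h
... | inj₁ h′ = let s⊑ , n≤ = lab-L P _ n h′ in ⊑-trans (⊑-++ s) s⊑ , n≤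
... | inj₂ h′ = let s⊑ , n≤ = lab-L Q _ n h′ in ⊑-trans (⊑-++ s) s⊑ , n≤
lab-L (ν x P)     s n h = lab-L P s n h

top-L : ∀ P s n {s′ n′} → (s′ , n′) ∈ top (L (s , n) P) → s ⊑ s′ × n ≤ n′
top-L P s n h = lab-L P s n (top⊆lab (L (s , n) P) h)

wf-L : ∀ P s n → wf (L (s , n) P)
wf-L 𝟘           s n = wf-𝟘
wf-L (inp x y P) s n = wf-inp x y P (s , n)
wf-L (out x y P) s n = wf-out x y P (s , n)
wf-L (P ∥ Q)     s n = wf-par (wf-L P _ n) (wf-L Q _ n) λ p q →
  branches-incomparable s (proj₁ (top-L P _ n p)) (proj₁ (top-L Q _ n q))
wf-L (ν x P)     s n = wf-ν (wf-L P s n)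
wf-L (! P)       s n = wf-rep (s , n) P

data Shape : Set where
  𝟘ˢ   : Shape
  inpˢ : Label → Shape → Shape
  outˢ : Label → Shape → Shape
  _∥ˢ_ : Shape → Shape → Shape
  νˢ   : Shape → Shape
  repˢ : Label → Shape

shape : LTerm → Shape
shape 𝟘             = 𝟘ˢ
shape (inp v x y E) = inpˢ v (shape E)
shape (out v x y E) = outˢ v (shape E)
shape (E ∥ F)       = shape E ∥ˢ shape F
shape (ν x E)       = νˢ (shape E)
shape (rep v P)     = repˢ v

shape-substE : ∀ z y E → shape (substE z y E) ≡ shape E
shape-substE z y 𝟘             = refl
shape-substE z y (inp v x w E) with does (w ≟ y)
... | true  = refl
... | false = cong (inpˢ v) (shape-substE z y E)
shape-substE z y (out v x w E) = cong (outˢ v) (shape-substE z y E)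
shape-substE z y (E ∥ F)       = cong₂ _∥ˢ_ (shape-substE z y E) (shape-substE z y F)
shape-substE z y (ν w E)       with does (w ≟ y)
... | true  = refl
... | false = cong νˢ (shape-substE z y E)
shape-substE z y (rep v P)     = refl

shape-≈α : ∀ {E F} → E ≈αE F → shape E ≡ shape F
shape-≈α α-refl                   = refl
shape-≈α (α-sym E≈F)              = sym (shape-≈α E≈F)
shape-≈α (α-trans E≈F F≈G)        = trans (shape-≈α E≈F) (shape-≈α F≈G)
shape-≈α (α-inp E≈F)              = cong (inpˢ _) (shape-≈α E≈F)
shape-≈α (α-out E≈F)              = cong (outˢ _) (shape-≈α E≈F)
shape-≈α (α-par E≈E′ F≈F′)        = cong₂ _∥ˢ_ (shape-≈α E≈E′) (shape-≈α F≈F′)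
shape-≈α (α-ν E≈F)                = cong νˢ (shape-≈α E≈F)
shape-≈α (α-rep P≈Q)              = refl
shape-≈α (α-inp-ren {y = y} {w} {E} _) = cong (inpˢ _) (sym (shape-substE w y E))
shape-≈α (α-ν-ren {y} {w} {E} _)       = cong νˢ (sym (shape-substE w y E))

topˢ : Shape → List Label
topˢ 𝟘ˢ         = []
topˢ (inpˢ v _) = [ v ]
topˢ (outˢ v _) = [ v ]
topˢ (a ∥ˢ b)   = topˢ a ++ topˢ b
topˢ (νˢ a)     = topˢ a
topˢ (repˢ v)   = [ v ]

top≡topˢ∘shape : ∀ E → top E ≡ topˢ (shape E)
top≡topˢ∘shape 𝟘             = refl
top≡topˢ∘shape (inp v x y E) = refl
top≡topˢ∘shape (out v x y E) = refl
top≡topˢ∘shape (E ∥ F)       = cong₂ _++_ (top≡topˢ∘shape E) (top≡topˢ∘shape F)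
top≡topˢ∘shape (ν x E)       = top≡topˢ∘shape E
top≡topˢ∘shape (rep v P)     = refl

top-shape : ∀ {E F} → shape E ≡ shape F → top E ≡ top F
top-shape {E} {F} e =
  trans (top≡topˢ∘shape E) (trans (cong topˢ e) (sym (top≡topˢ∘shape F)))

-- LabelledFrom v a: a is the shape of L v P for some P.
LabelledFrom : Label → Shape → Set
LabelledFrom v       𝟘ˢ         = ⊤
LabelledFrom (s , n) (inpˢ w a) = w ≡ (s , n) × LabelledFrom (s , suc n) a
LabelledFrom (s , n) (outˢ w a) = w ≡ (s , n) × LabelledFrom (s , suc n) a
LabelledFrom (s , n) (a ∥ˢ b)   =
  LabelledFrom (s ++ [ false ] , n) a × LabelledFrom (s ++ [ true ] , n) b
LabelledFrom v       (νˢ a)     = LabelledFrom v a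
LabelledFrom v       (repˢ w)   = w ≡ v

labelledFrom-L : ∀ P s n → LabelledFrom (s , n) (shape (L (s , n) P))
labelledFrom-L 𝟘           s n = tt
labelledFrom-L (inp x y P) s n = refl , labelledFrom-L P s (suc n)
labelledFrom-L (out x y P) s n = refl , labelledFrom-L P s (suc n)
labelledFrom-L (P ∥ Q)     s n = labelledFrom-L P _ n , labelledFrom-L Q _ n
labelledFrom-L (ν x P)     s n = labelledFrom-L P s n
labelledFrom-L (! P)       s n = refl

unlabel : LTerm → Proc
unlabel 𝟘             = 𝟘
unlabel (inp v x y E) = inp x y (unlabel E)
unlabel (out v x y E) = out x y (unlabel E)
unlabel (E ∥ F)       = unlabel E ∥ unlabel F
unlabel (ν x E)       = ν x (unlabel E)
unlabel (rep v P)     = ! P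

labelledFrom⇒≡L : ∀ E s n → LabelledFrom (s , n) (shape E) → E ≡ L (s , n) (unlabel E)
labelledFrom⇒≡L 𝟘             s n _          = refl
labelledFrom⇒≡L (inp v x y E) s n (refl , a) = cong (inp v x y) (labelledFrom⇒≡L E s (suc n) a)
labelledFrom⇒≡L (out v x y E) s n (refl , a) = cong (out v x y) (labelledFrom⇒≡L E s (suc n) a)
labelledFrom⇒≡L (E ∥ F)       s n (a , b)    =
  cong₂ _∥_ (labelledFrom⇒≡L E _ n a) (labelledFrom⇒≡L F _ n b)
labelledFrom⇒≡L (ν x E)       s n a          = cong (ν x) (labelledFrom⇒≡L E s n a)
labelledFrom⇒≡L (rep v P)     s n refl       = refl

WFˢ : Shape → Set
WFˢ 𝟘ˢ                 = ⊤
WFˢ (inpˢ (s , n) a)   = LabelledFrom (s , suc n) a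
WFˢ (outˢ (s , n) a)   = LabelledFrom (s , suc n) a
WFˢ (a ∥ˢ b)           = WFˢ a × WFˢ b × topˢ a ℜ topˢ b
WFˢ (νˢ a)             = WFˢ a
WFˢ (repˢ v)           = ⊤

wf⇒WFˢ : ∀ {E} → wf E → WFˢ (shape E)
wf⇒WFˢ wf-𝟘                     = tt
wf⇒WFˢ (wf-inp x y P (s , n))   = labelledFrom-L P s (suc n)
wf⇒WFˢ (wf-out x y P (s , n))   = labelledFrom-L P s (suc n)
wf⇒WFˢ (wf-par {E₀} {E₁} w₀ w₁ R) =
  wf⇒WFˢ w₀ , wf⇒WFˢ w₁ ,
  subst₂ _ℜ_ (top≡topˢ∘shape E₀) (top≡topˢ∘shape E₁) R
wf⇒WFˢ (wf-ν w)                 = wf⇒WFˢ w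
wf⇒WFˢ (wf-rep v P)             = tt

WFˢ⇒wf : ∀ E → WFˢ (shape E) → wf E
WFˢ⇒wf 𝟘                   _ = wf-𝟘
WFˢ⇒wf (inp (s , n) x y E) a =
  subst (λ F → wf (inp (s , n) x y F)) (sym (labelledFrom⇒≡L E s (suc n) a))
        (wf-inp x y (unlabel E) (s , n))
WFˢ⇒wf (out (s , n) x y E) a =
  subst (λ F → wf (out (s , n) x y F)) (sym (labelledFrom⇒≡L E s (suc n) a))
        (wf-out x y (unlabel E) (s , n))
WFˢ⇒wf (E ∥ F) (a , b , R) =
  wf-par (WFˢ⇒wf E a) (WFˢ⇒wf F b)
         (subst₂ _ℜ_ (sym (top≡topˢ∘shape E)) (sym (top≡topˢ∘shape F)) R)
WFˢ⇒wf (ν x E)             a = wf-ν (WFˢ⇒wf E a)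
WFˢ⇒wf (rep v P)           _ = wf-rep v P

wf-shape : ∀ {E F} → shape E ≡ shape F → wf E → wf F
wf-shape {F = F} e w = WFˢ⇒wf F (subst WFˢ e (wf⇒WFˢ w))

top-separated : ∀ {E} → wf E → Separated (top E)
top-separated wf-𝟘                  = separated-[]
top-separated (wf-inp x y P v)      = separated-[ v ]
top-separated (wf-out x y P v)      = separated-[ v ]
top-separated (wf-par w₀ w₁ R)      = separated-++ (top-separated w₀) (top-separated w₁) R
top-separated (wf-ν w)              = top-separated w
top-separated (wf-rep v P)          = separated-[ v ]

top≼lab : ∀ {E} → wf E → top E ≼ lab E
top≼lab wf-𝟘 ()
top≼lab (wf-inp x y P (s , n)) h = s , n , here refl , lab-L (inp x y P) s n h
top≼lab (wf-out x y P (s , n)) h = s , n , here refl , lab-L (out x y P) s n h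
top≼lab (wf-par {E₀} w₀ w₁ _) h with ∈-++⁻ (lab E₀) h
... | inj₁ h′ = let r , m , k , rest = top≼lab w₀ h′ in r , m , ∈-++⁺ˡ k , rest
... | inj₂ h′ = let r , m , k , rest = top≼lab w₁ h′ in r , m , ∈-++⁺ʳ (top E₀) k , rest
top≼lab (wf-ν w) h = top≼lab w h
top≼lab (wf-rep (s , n) P) (here refl) = s , n , here refl , ⊑-refl s , ≤-refl

infix 4 _↦_

-- A record rather than a product, so that E and E′ stay inferable.
record _↦_ (E E′ : LTerm) : Set where
  constructor _,_
  field
    top-≼ : top E ≼ top E′
    wf′   : wf E′

↦-shapeˡ : ∀ {E F G} → shape E ≡ shape F → F ↦ G → E ↦ G
↦-shapeˡ e (F≼G , wfG) = subst (_≼ _) (sym (top-shape e)) F≼G , wfG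

↦-shapeʳ : ∀ {E F F′} → shape F ≡ shape F′ → E ↦ F → E ↦ F′
↦-shapeʳ e (E≼F , wfF) = subst (_ ≼_) (top-shape e) E≼F , wf-shape e wfF

successor-above : ∀ P s n → [ (s , n) ] ≼ top (L (s , suc n) P)
successor-above P s n h =
  let s⊑ , n< = top-L P s (suc n) h in s , n , here refl , s⊑ , ≤-trans (n≤1+n n) n<

↦-replication : ∀ s n P P′ →
  rep (s , n) P ↦ (L (s ++ [ false ] , suc n) P′ ∥ rep (s ++ [ true ] , suc n) P)
↦-replication s n P P′ = residual≽ , wf-par (wf-L P′ _ (suc n)) (wf-rep _ P) apart
  where
  residual≽ : [ (s , n) ] ≼ top (L (s ++ [ false ] , suc n) P′) ++ [ (s ++ [ true ] , suc n) ]
  residual≽ h with ∈-++⁻ (top (L (s ++ [ false ] , suc n) P′)) h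
  ... | inj₁ h′ = let s⊑ , n< = top-L P′ _ (suc n) h′ in
                  s , n , here refl , ⊑-trans (⊑-++ s) s⊑ , ≤-trans (n≤1+n n) n<
  ... | inj₂ (here refl) = s , n , here refl , ⊑-++ s , n≤1+n n
  apart : top (L (s ++ [ false ] , suc n) P′) ℜ [ (s ++ [ true ] , suc n) ]
  apart h (here refl) =
    branches-incomparable s (proj₁ (top-L P′ _ (suc n) h)) (⊑-refl _)

↦-∥ : ∀ {E₀ E₁ E₀′ E₁′} → top E₀ ℜ top E₁ → E₀ ↦ E₀′ → E₁ ↦ E₁′ →
  (E₀ ∥ E₁) ↦ (E₀′ ∥ E₁′)
↦-∥ R (≼₀ , w₀) (≼₁ , w₁) = ≼-++ ≼₀ ≼₁ , wf-par w₀ w₁ (ℜ-mono ≼₀ ≼₁ R)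

↦-idle : ∀ {E} → wf E → E ↦ E
↦-idle {E} w = ≼-refl (top E) , w

↦-ν : ∀ {x E E′} → E ↦ E′ → E ↦ ν x E′
↦-ν (≼′ , w) = ≼′ , wf-ν w

ν-↦ : ∀ {x E E′} → E ↦ E′ → ν x E ↦ E′
ν-↦ (≼′ , w) = ≼′ , w

transition-↦ : ∀ {E μ E′} → E —[ μ ]→ E′ → wf E → E ↦ E′
transition-↦ (t-inp {y = y} {z} {E} _) (wf-inp x _ P (s , n)) =
  ↦-shapeʳ (sym (shape-substE z y E)) (successor-above P s n , wf-L P s (suc n))
transition-↦ t-out (wf-out x y P (s , n)) = successor-above P s n , wf-L P s (suc n)
transition-↦ (t-open t _)         (wf-ν w)          = ν-↦ (transition-↦ t w)
transition-↦ (t-res t _)          (wf-ν w)          = ν-↦ (↦-ν (transition-↦ t w))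
transition-↦ (t-parL t _)         (wf-par w₀ w₁ R)  = ↦-∥ R (transition-↦ t w₀) (↦-idle w₁)
transition-↦ (t-parR t _)         (wf-par w₀ w₁ R)  = ↦-∥ R (↦-idle w₀) (transition-↦ t w₁)
transition-↦ (t-comL t₀ t₁)       (wf-par w₀ w₁ R)  = ↦-∥ R (transition-↦ t₀ w₀) (transition-↦ t₁ w₁)
transition-↦ (t-comR t₀ t₁)       (wf-par w₀ w₁ R)  = ↦-∥ R (transition-↦ t₀ w₀) (transition-↦ t₁ w₁)
transition-↦ (t-closeL t₀ t₁ _)   (wf-par w₀ w₁ R)  =
  ↦-ν (↦-∥ R (transition-↦ t₀ w₀) (transition-↦ t₁ w₁))
transition-↦ (t-closeR t₀ t₁ _)   (wf-par w₀ w₁ R)  =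
  ↦-ν (↦-∥ R (transition-↦ t₀ w₀) (transition-↦ t₁ w₁))
transition-↦ (t-rep {s = s} {n} {P} {P′} _) (wf-rep _ _) = ↦-replication s n P P′
transition-↦ (t-alpha E≈E₀ t E₀′≈E′) w =
  ↦-shapeˡ (shape-≈α E≈E₀) (↦-shapeʳ (shape-≈α E₀′≈E′)
    (transition-↦ t (wf-shape (shape-≈α E≈E₀) w)))

lemmaA5 : ∀ (E : LTerm) → wf E →
    (∀ {r m r' m'} → (r , m) ∈ top E → (r' , m') ∈ top E → (r , m) ≢ (r' , m') →
        [ (r , m) ] ℜ [ (r' , m') ])
    × (∀ {s n} → (s , n) ∈ lab E →
        ∃ λ r → ∃ λ m → (r , m) ∈ top E × r ⊑ s × m ≤ n)
    × (∀ {μ E'} → E —[ μ ]→ E' →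
        (∀ {r' m'} → (r' , m') ∈ top E' →
           ∃ λ r → ∃ λ m → (r , m) ∈ top E × r ⊑ r' × m ≤ m')
        × wf E')
lemmaA5 E w = top-separated w , top≼lab w , λ t →
  let open _↦_ (transition-↦ t w) in top-≼ , wf′
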